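{- If $n$ is odd, then $R_{\mathrm{Heis}_n}$ is a characteristic subgroup of $F_2$, i.e. every automorphism of $F_2$ maps $R_{\mathrm{Heis}_n}$ onto itself.
   Context: $F_2$ is the free group on $a,b$. $H_n$ is the group of $3\times3$ upper unitriangular matrices over $\mathbb{Z}/n\mathbb{Z}$, $\alpha$ (resp. $\beta$) the matrix with $1$ in position $(1,2)$ (resp. $(2,3)$). $R_{\mathrm{Heis}_n}$ is the kernel of the surjection $F_2\to H_n$, $a\mapsto\alpha$, $b\mapsto\beta$; equivalently the normal closure of $a^n,b^n,[a,T],[b,T]$ where $[x,y]=xyx^{ -1}y^{ -1}$ and $T=[a,b]$. -}

module Defs where

open import Data.Nat using (ℕ)
open import Data.Nat.Divisibility using () renaming (_∣_ to _∣ℕ_)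
open import Data.Integer using (ℤ; +_; -_; _+_; _*_; 0ℤ; 1ℤ)
open import Data.Integer.Divisibility using (_∣_)
open import Data.Fin using (Fin; zero; suc)
open import Data.Bool using (Bool; true; false; not)
open import Data.List using (List; []; _∷_; _++_; reverse; map; concatMap)
open import Data.Product using (_×_; _,_; ∃)
open import Relation.Nullary using (¬_)

-- The free group F₂ on a = zero, b = suc zero.
-- A letter is a generator together with an exponent sign
-- (false = x, true = x⁻¹).  Elements of F₂ are words modulo free
-- equivalence _≈_ (the congruence generated by cancelling x x⁻¹).

Letter : Set
Letter = Fin 2 × Bool

Word : Set
Word = List Letter

invL : Letter → Letter
invL (i , s) = (i , not s)

inv : Word → Word
inv w = reverse (Data.List.map invL w)

infix 4 _≈_
data _≈_ : Word → Word → Set where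
  ≈-refl   : ∀ {u} → u ≈ u
  ≈-sym    : ∀ {u v} → u ≈ v → v ≈ u
  ≈-trans  : ∀ {u v w} → u ≈ v → v ≈ w → u ≈ w
  ≈-cancel : ∀ u x v → (u ++ x ∷ invL x ∷ v) ≈ (u ++ v)

-- Group automorphism of F₂ (F₂ viewed as the setoid group
-- (Word, _≈_, _++_, [], inv)): a well-defined multiplicative map
-- which is bijective on ≈-classes.
record IsAutF₂ (φ : Word → Word) : Set where
  field
    φ-cong  : ∀ {u v} → u ≈ v → φ u ≈ φ v
    φ-hom   : ∀ u v → φ (u ++ v) ≈ (φ u ++ φ v)
    φ-inj   : ∀ {u v} → φ u ≈ φ v → u ≈ v
    φ-surj  : ∀ w → ∃ λ u → φ u ≈ w

-- The Heisenberg group: 3×3 upper unitriangular matrices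
--   [ 1 x z ]
--   [ 0 1 y ]
--   [ 0 0 1 ]
-- with integer entries; the matrix product is
--   (x,y,z)(x',y',z') = (x+x', y+y', z+z'+x y').
-- Entries are taken in ℤ and reduced mod n at the end (H(ℤ) → H_n is
-- the entrywise reduction homomorphism).

record UT3 : Set where
  constructor ut
  field
    e12 : ℤ
    e23 : ℤ
    e13 : ℤ

infixl 7 _·_
_·_ : UT3 → UT3 → UT3
ut x y z · ut x' y' z' = ut (x + x') (y + y') (z + z' + x * y')

I₃ : UT3
I₃ = ut 0ℤ 0ℤ 0ℤ

evalL : Letter → UT3
evalL (zero , false)     = ut 1ℤ 0ℤ 0ℤ
evalL (zero , true)      = ut (- 1ℤ) 0ℤ 0ℤ
evalL (suc zero , false) = ut 0ℤ 1ℤ 0ℤ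
evalL (suc zero , true)  = ut 0ℤ (- 1ℤ) 0ℤ

eval : Word → UT3
eval []      = I₃
eval (l ∷ w) = evalL l · eval w

IsIdₙ : ℕ → UT3 → Set
IsIdₙ n (ut x y z) = ((+ n) ∣ x) × ((+ n) ∣ y) × ((+ n) ∣ z)

-- R_{Heis_n}: kernel of F₂ → H_n, a ↦ α, b ↦ β
InR : ℕ → Word → Set
InR n w = IsIdₙ n (eval w)

Odd : ℕ → Set
Odd n = ¬ (2 ∣ℕ n)

-- Every endomorphism φ of F₂ induces an endomorphism Φ of H(ℤ) = F₂/γ₃F₂, determined by
-- A = Φ α and B = Φ β.  In the coordinates (x, y, s) with s = 2z − xy, Φ is polynomial: it acts
-- on (x, y) by the matrix with columns A, B and sends s to x·s(A) + y·s(B) + s·det(A, B).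
-- A matrix reduces to the identity of H_n iff n divides x, y and z; for odd n, 2 is invertible
-- mod n, so this is equivalent to n dividing x, y and s, a condition visibly preserved by Φ.
-- Applied to φ and φ⁻¹ this gives φ(R) = R.
module Submission where

open import Defs
open import Data.Nat using (ℕ)
open import Data.Product using (_×_; _,_; ∃; proj₁; proj₂)

open import Level using (0ℓ)
open import Algebra.Bundles using (Group)
open import Algebra.Structures using (IsGroup)
open import Data.Bool using (true; false)
open import Data.Fin using (zero; suc)
open import Data.Integer using (ℤ; +_; -_; _+_; _-_; _*_; 0ℤ; 1ℤ)
open import Data.Integer.Properties
  using (+-assoc; +-identityˡ; +-identityʳ; +-inverseˡ; +-inverseʳ; abs-*)
open import Data.Integer.Divisibility.Signed
  using (_∣_; ∣ᵤ⇒∣; ∣⇒∣ᵤ; ∣m∣n⇒∣m+n; ∣m∣n⇒∣m-n; ∣m+n∣n⇒∣m; ∣m⇒∣-m; ∣m⇒∣m*n; ∣n⇒∣m*n)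
open import Data.Integer.Tactic.RingSolver using (solve; solve-∀)
open import Data.List using ([]; _∷_; _++_; [_])
open import Data.List.Properties using (++-assoc)
open import Data.Nat.Coprimality using (Coprime; coprime-divisor)
open import Data.Nat.Divisibility using () renaming (_∣_ to _∣ℕ_)
open import Data.Nat.Primality using (irreducible[2])
open import Data.Sum using (inj₁; inj₂)
open import Function using (_∘_)
open import Relation.Binary.Bundles using (Setoid)
open import Relation.Binary.PropositionalEquality
  using (_≡_; refl; sym; trans; cong; cong₂; subst; subst₂; module ≡-Reasoning)
open import Relation.Binary.PropositionalEquality.Algebra using (isMagma)
open import Relation.Nullary using (contradiction)

open UT3

ut-≡ : ∀ {x y z x′ y′ z′} → x ≡ x′ → y ≡ y′ → z ≡ z′ → ut x y z ≡ ut x′ y′ z′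
ut-≡ refl refl refl = refl

infix 8 _⁻¹
_⁻¹ : UT3 → UT3
ut x y z ⁻¹ = ut (- x) (- y) (x * y - z)

·-assoc : ∀ X Y Z → (X · Y) · Z ≡ X · (Y · Z)
·-assoc (ut x y z) (ut x′ y′ z′) (ut x″ y″ z″) =
  ut-≡ (+-assoc x x′ x″) (+-assoc y y′ y″) corner
  where
  corner : z + z′ + x * y′ + z″ + (x + x′) * y″ ≡ z + (z′ + z″ + x′ * y″) + x * (y′ + y″)
  corner = solve (x ∷ x′ ∷ y′ ∷ y″ ∷ z ∷ z′ ∷ z″ ∷ [])

·-identityˡ : ∀ X → I₃ · X ≡ X
·-identityˡ (ut x y z) = ut-≡ (+-identityˡ x) (+-identityˡ y) corner
  where
  corner : 0ℤ + z + 0ℤ * y ≡ z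
  corner = solve (y ∷ z ∷ [])

·-identityʳ : ∀ X → X · I₃ ≡ X
·-identityʳ (ut x y z) = ut-≡ (+-identityʳ x) (+-identityʳ y) corner
  where
  corner : z + 0ℤ + x * 0ℤ ≡ z
  corner = solve (x ∷ z ∷ [])

⁻¹-inverseˡ : ∀ X → X ⁻¹ · X ≡ I₃
⁻¹-inverseˡ (ut x y z) = ut-≡ (+-inverseˡ x) (+-inverseˡ y) corner
  where
  corner : x * y - z + z + (- x) * y ≡ 0ℤ
  corner = solve (x ∷ y ∷ z ∷ [])

⁻¹-inverseʳ : ∀ X → X · X ⁻¹ ≡ I₃
⁻¹-inverseʳ (ut x y z) = ut-≡ (+-inverseʳ x) (+-inverseʳ y) corner
  where
  corner : z + (x * y - z) + x * (- y) ≡ 0ℤ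
  corner = solve (x ∷ y ∷ z ∷ [])

·-isGroup : IsGroup _≡_ _·_ I₃ _⁻¹
·-isGroup = record
  { isMonoid = record
    { isSemigroup = record { isMagma = isMagma _·_ ; assoc = ·-assoc }
    ; identity    = ·-identityˡ , ·-identityʳ
    }
  ; inverse = ⁻¹-inverseˡ , ⁻¹-inverseʳ
  ; ⁻¹-cong = cong _⁻¹
  }

heisenberg : Group 0ℓ 0ℓ
heisenberg = record { isGroup = ·-isGroup }

open import Algebra.Properties.Group heisenberg
  using (\\-leftDividesˡ; identityˡ-unique; inverseʳ-unique)

α β : UT3
α = evalL (zero , false)
β = evalL (suc zero , false)

evalL-invL : ∀ l → evalL (invL l) ≡ evalL l ⁻¹
evalL-invL (zero , false)     = refl
evalL-invL (zero , true)      = refl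
evalL-invL (suc zero , false) = refl
evalL-invL (suc zero , true)  = refl

eval-++ : ∀ u v → eval (u ++ v) ≡ eval u · eval v
eval-++ []      v = sym (·-identityˡ (eval v))
eval-++ (l ∷ u) v = begin
  evalL l · eval (u ++ v)      ≡⟨ cong (evalL l ·_) (eval-++ u v) ⟩
  evalL l · (eval u · eval v)  ≡⟨ ·-assoc (evalL l) (eval u) (eval v) ⟨
  (evalL l · eval u) · eval v  ∎
  where open ≡-Reasoning

eval-cong : ∀ {u v} → u ≈ v → eval u ≡ eval v
eval-cong ≈-refl        = refl
eval-cong (≈-sym p)     = sym (eval-cong p)
eval-cong (≈-trans p q) = trans (eval-cong p) (eval-cong q)
eval-cong (≈-cancel u l v) = begin
  eval (u ++ l ∷ invL l ∷ v)                      ≡⟨ eval-++ u (l ∷ invL l ∷ v) ⟩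
  eval u · (evalL l · (evalL (invL l) · eval v))  ≡⟨ cong (λ L → eval u · (evalL l · (L · eval v))) (evalL-invL l) ⟩
  eval u · (evalL l · (evalL l ⁻¹ · eval v))      ≡⟨ cong (eval u ·_) (\\-leftDividesˡ (evalL l) (eval v)) ⟩
  eval u · eval v                                 ≡⟨ eval-++ u v ⟨
  eval (u ++ v)                                   ∎
  where open ≡-Reasoning

≈-setoid : Setoid 0ℓ 0ℓ
≈-setoid = record
  { Carrier       = Word
  ; _≈_           = _≈_
  ; isEquivalence = record { refl = ≈-refl ; sym = ≈-sym ; trans = ≈-trans }
  }

++-congˡ : ∀ {u u′} v → u ≈ u′ → u ++ v ≈ u′ ++ v
++-congˡ v ≈-refl        = ≈-refl
++-congˡ v (≈-sym p)     = ≈-sym (++-congˡ v p)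
++-congˡ v (≈-trans p q) = ≈-trans (++-congˡ v p) (++-congˡ v q)
++-congˡ v (≈-cancel u l w) =
  subst₂ _≈_ (sym (++-assoc u (l ∷ invL l ∷ w) v)) (sym (++-assoc u w v)) (≈-cancel u l (w ++ v))

++-congʳ : ∀ u {v v′} → v ≈ v′ → u ++ v ≈ u ++ v′
++-congʳ u ≈-refl        = ≈-refl
++-congʳ u (≈-sym p)     = ≈-sym (++-congʳ u p)
++-congʳ u (≈-trans p q) = ≈-trans (++-congʳ u p) (++-congʳ u q)
++-congʳ u (≈-cancel w l v) =
  subst₂ _≈_ (++-assoc u w (l ∷ invL l ∷ v)) (++-assoc u w v) (≈-cancel (u ++ w) l v)

++-cong : ∀ {u u′ v v′} → u ≈ u′ → v ≈ v′ → u ++ v ≈ u′ ++ v′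
++-cong {u′ = u′} {v = v} p q = ≈-trans (++-congˡ v p) (++-congʳ u′ q)

record IsEndF₂ (φ : Word → Word) : Set where
  field
    φ-cong : ∀ {u v} → u ≈ v → φ u ≈ φ v
    φ-hom  : ∀ u v → φ (u ++ v) ≈ (φ u ++ φ v)

module AutF₂ {φ : Word → Word} (aut : IsAutF₂ φ) where
  open IsAutF₂ aut
  open import Relation.Binary.Reasoning.Setoid ≈-setoid

  isEnd : IsEndF₂ φ
  isEnd = record { φ-cong = φ-cong ; φ-hom = φ-hom }

  φ⁻¹ : Word → Word
  φ⁻¹ w = proj₁ (φ-surj w)

  φ∘φ⁻¹ : ∀ w → φ (φ⁻¹ w) ≈ w
  φ∘φ⁻¹ w = proj₂ (φ-surj w)

  isEnd⁻¹ : IsEndF₂ φ⁻¹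
  isEnd⁻¹ = record { φ-cong = φ⁻¹-cong ; φ-hom = φ⁻¹-hom }
    where
    φ⁻¹-cong : ∀ {u v} → u ≈ v → φ⁻¹ u ≈ φ⁻¹ v
    φ⁻¹-cong {u} {v} u≈v = φ-inj (begin
      φ (φ⁻¹ u)  ≈⟨ φ∘φ⁻¹ u ⟩
      u          ≈⟨ u≈v ⟩
      v          ≈⟨ φ∘φ⁻¹ v ⟨
      φ (φ⁻¹ v)  ∎)

    φ⁻¹-hom : ∀ u v → φ⁻¹ (u ++ v) ≈ (φ⁻¹ u ++ φ⁻¹ v)
    φ⁻¹-hom u v = φ-inj (begin
      φ (φ⁻¹ (u ++ v))           ≈⟨ φ∘φ⁻¹ (u ++ v) ⟩
      u ++ v                     ≈⟨ ++-cong (φ∘φ⁻¹ u) (φ∘φ⁻¹ v) ⟨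
      φ (φ⁻¹ u) ++ φ (φ⁻¹ v)     ≈⟨ φ-hom (φ⁻¹ u) (φ⁻¹ v) ⟨
      φ (φ⁻¹ u ++ φ⁻¹ v)         ∎)

-- Twice the central coordinate z − xy/2 of the symmetric gauge: unlike z, it transforms
-- polynomially under endomorphisms of H(ℤ).
symCentre : UT3 → ℤ
symCentre (ut x y z) = + 2 * z - x * y

det : UT3 → UT3 → ℤ
det (ut x y _) (ut x′ y′ _) = x * y′ - x′ * y

symCentre-· : ∀ X Y → symCentre (X · Y) ≡ symCentre X + symCentre Y + det X Y
symCentre-· (ut x y z) (ut x′ y′ z′) = begin
  + 2 * (z + z′ + x * y′) - (x + x′) * (y + y′)                 ≡⟨ solve (x ∷ y ∷ z ∷ x′ ∷ y′ ∷ z′ ∷ []) ⟩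
  (+ 2 * z - x * y) + (+ 2 * z′ - x′ * y′) + (x * y′ - x′ * y)  ∎
  where open ≡-Reasoning

symCentre-⁻¹ : ∀ X → symCentre (X ⁻¹) ≡ - symCentre X
symCentre-⁻¹ (ut x y z) = begin
  + 2 * (x * y - z) - (- x) * (- y)  ≡⟨ solve (x ∷ y ∷ z ∷ []) ⟩
  - (+ 2 * z - x * y)                ∎
  where open ≡-Reasoning

lincomb-+ : ∀ x y x′ y′ a b → (x * a + y * b) + (x′ * a + y′ * b) ≡ (x + x′) * a + (y + y′) * b
lincomb-+ = solve-∀

lincomb-neg : ∀ x y a b → - (x * a + y * b) ≡ (- x) * a + (- y) * b
lincomb-neg = solve-∀

affine-+ : ∀ x y s x′ y′ s′ t a b d →
           (x * a + y * b + s * d) + (x′ * a + y′ * b + s′ * d) + t * d ≡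
           (x + x′) * a + (y + y′) * b + (s + s′ + t) * d
affine-+ = solve-∀

affine-neg : ∀ x y s a b d → - (x * a + y * b + s * d) ≡ (- x) * a + (- y) * b + (- s) * d
affine-neg = solve-∀

det-lincomb : ∀ x y x′ y′ a₁ a₂ b₁ b₂ →
              (x * a₁ + y * b₁) * (x′ * a₂ + y′ * b₂) - (x′ * a₁ + y′ * b₁) * (x * a₂ + y * b₂) ≡
              (x * y′ - x′ * y) * (a₁ * b₂ - b₁ * a₂)
det-lincomb = solve-∀

-- The graph of the endomorphism of H(ℤ) with α ↦ A and β ↦ B, in symmetric coordinates; it is
-- a relation because recovering z from 2z − xy needs a division by 2.
record IsImage (A B X E : UT3) : Set where
  constructor image
  field
    e12-image       : e12 E ≡ e12 X * e12 A + e23 X * e12 B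
    e23-image       : e23 E ≡ e12 X * e23 A + e23 X * e23 B
    symCentre-image : symCentre E ≡ e12 X * symCentre A + e23 X * symCentre B + symCentre X * det A B

IsImage-I₃ : ∀ A B → IsImage A B I₃ I₃
IsImage-I₃ A B = image refl refl refl

IsImage-α : ∀ A B → IsImage A B α A
IsImage-α A B = image (select₁ (e12 A) (e12 B)) (select₁ (e23 A) (e23 B))
  (trans (select₁ (symCentre A) (symCentre B)) (sym (+-identityʳ _)))
  where
  select₁ : ∀ a b → a ≡ 1ℤ * a + 0ℤ * b
  select₁ = solve-∀

IsImage-β : ∀ A B → IsImage A B β B
IsImage-β A B = image (select₂ (e12 A) (e12 B)) (select₂ (e23 A) (e23 B))
  (trans (select₂ (symCentre A) (symCentre B)) (sym (+-identityʳ _)))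
  where
  select₂ : ∀ a b → b ≡ 0ℤ * a + 1ℤ * b
  select₂ = solve-∀

IsImage-· : ∀ {A B X Y E F} → IsImage A B X E → IsImage A B Y F → IsImage A B (X · Y) (E · F)
IsImage-· {A@(ut a₁ a₂ _)} {B@(ut b₁ b₂ _)} {X@(ut x y _)} {Y@(ut x′ y′ _)} {E} {F}
          (image E₁ E₂ Eₛ) (image F₁ F₂ Fₛ) = image
  (trans (cong₂ _+_ E₁ F₁) (lincomb-+ x y x′ y′ a₁ b₁))
  (trans (cong₂ _+_ E₂ F₂) (lincomb-+ x y x′ y′ a₂ b₂))
  (begin
    symCentre (E · F)                                      ≡⟨ symCentre-· E F ⟩
    symCentre E + symCentre F + det E F                    ≡⟨ cong₂ _+_ (cong₂ _+_ Eₛ Fₛ) det-EF ⟩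
    (x * sA + y * sB + symCentre X * D) + (x′ * sA + y′ * sB + symCentre Y * D) + det X Y * D
      ≡⟨ affine-+ x y (symCentre X) x′ y′ (symCentre Y) (det X Y) sA sB D ⟩
    (x + x′) * sA + (y + y′) * sB + (symCentre X + symCentre Y + det X Y) * D
      ≡⟨ cong (λ s → (x + x′) * sA + (y + y′) * sB + s * D) (symCentre-· X Y) ⟨
    (x + x′) * sA + (y + y′) * sB + symCentre (X · Y) * D  ∎)
  where
  open ≡-Reasoning
  sA sB D : ℤ
  sA = symCentre A
  sB = symCentre B
  D  = det A B

  det-EF : det E F ≡ det X Y * D
  det-EF = trans (cong₂ _-_ (cong₂ _*_ E₁ F₂) (cong₂ _*_ F₁ E₂)) (det-lincomb x y x′ y′ a₁ a₂ b₁ b₂)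

IsImage-⁻¹ : ∀ {A B X E} → IsImage A B X E → IsImage A B (X ⁻¹) (E ⁻¹)
IsImage-⁻¹ {A@(ut a₁ a₂ _)} {B@(ut b₁ b₂ _)} {X@(ut x y _)} {E} (image E₁ E₂ Eₛ) = image
  (trans (cong -_ E₁) (lincomb-neg x y a₁ b₁))
  (trans (cong -_ E₂) (lincomb-neg x y a₂ b₂))
  (begin
    symCentre (E ⁻¹)                                  ≡⟨ symCentre-⁻¹ E ⟩
    - symCentre E                                     ≡⟨ cong -_ Eₛ ⟩
    - (x * sA + y * sB + symCentre X * D)             ≡⟨ affine-neg x y (symCentre X) sA sB D ⟩
    (- x) * sA + (- y) * sB + (- symCentre X) * D     ≡⟨ cong (λ s → (- x) * sA + (- y) * sB + s * D) (symCentre-⁻¹ X) ⟨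
    (- x) * sA + (- y) * sB + symCentre (X ⁻¹) * D    ∎)
  where
  open ≡-Reasoning
  sA sB D : ℤ
  sA = symCentre A
  sB = symCentre B
  D  = det A B

module HomToHeisenberg (h : Word → UT3)
    (h-cong : ∀ {u v} → u ≈ v → h u ≡ h v)
    (h-hom  : ∀ u v → h (u ++ v) ≡ h u · h v) where

  h-[] : h [] ≡ I₃
  h-[] = identityˡ-unique (h []) (h []) (sym (h-hom [] []))

  h-invL : ∀ l → h [ invL l ] ≡ h [ l ] ⁻¹
  h-invL l = inverseʳ-unique (h [ l ]) (h [ invL l ]) (begin
    h [ l ] · h [ invL l ]  ≡⟨ h-hom [ l ] [ invL l ] ⟨
    h (l ∷ invL l ∷ [])     ≡⟨ h-cong (≈-cancel [] l []) ⟩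
    h []                    ≡⟨ h-[] ⟩
    I₃                      ∎)
    where open ≡-Reasoning

  A B : UT3
  A = h [ zero , false ]
  B = h [ suc zero , false ]

  IsImage-letter : ∀ l → IsImage A B (evalL l) (h [ l ])
  IsImage-letter (zero , false)     = IsImage-α A B
  IsImage-letter (zero , true)      =
    subst (IsImage A B (α ⁻¹)) (sym (h-invL (zero , false))) (IsImage-⁻¹ (IsImage-α A B))
  IsImage-letter (suc zero , false) = IsImage-β A B
  IsImage-letter (suc zero , true)  =
    subst (IsImage A B (β ⁻¹)) (sym (h-invL (suc zero , false))) (IsImage-⁻¹ (IsImage-β A B))

  IsImage-eval : ∀ w → IsImage A B (eval w) (h w)
  IsImage-eval []      = subst (IsImage A B I₃) (sym h-[]) (IsImage-I₃ A B)
  IsImage-eval (l ∷ w) = subst (IsImage A B (evalL l · eval w)) (sym (h-hom [ l ] w))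
                           (IsImage-· (IsImage-letter l) (IsImage-eval w))

coprime-2 : ∀ {n} → Odd n → Coprime n 2
coprime-2 odd (d∣n , d∣2) with irreducible[2] d∣2
... | inj₁ d≡1  = d≡1
... | inj₂ refl = contradiction d∣n odd

∣-half : ∀ {n e} → Odd n → + n ∣ + 2 * e → + n ∣ e
∣-half {n} {e} odd n∣2e =
  ∣ᵤ⇒∣ (coprime-divisor (coprime-2 odd) (subst (n ∣ℕ_) (abs-* (+ 2) e) (∣⇒∣ᵤ n∣2e)))

infix 4 _∣ˢ_
_∣ˢ_ : ℕ → UT3 → Set
n ∣ˢ X = + n ∣ e12 X × + n ∣ e23 X × + n ∣ symCentre X

IsIdₙ⇒∣ˢ : ∀ n X → IsIdₙ n X → n ∣ˢ X
IsIdₙ⇒∣ˢ n (ut x y z) (n∣x , n∣y , n∣z) =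
  n∣x′ , ∣ᵤ⇒∣ {+ n} {y} n∣y , ∣m∣n⇒∣m-n (∣n⇒∣m*n (+ 2) (∣ᵤ⇒∣ {+ n} {z} n∣z)) (∣m⇒∣m*n y n∣x′)
  where
  n∣x′ : + n ∣ x
  n∣x′ = ∣ᵤ⇒∣ {+ n} {x} n∣x

∣ˢ⇒IsIdₙ : ∀ {n} X → Odd n → n ∣ˢ X → IsIdₙ n X
∣ˢ⇒IsIdₙ (ut x y z) odd (n∣x , n∣y , n∣s) =
  ∣⇒∣ᵤ n∣x , ∣⇒∣ᵤ n∣y , ∣⇒∣ᵤ (∣-half {e = z} odd (∣m+n∣n⇒∣m n∣s (∣m⇒∣-m (∣m⇒∣m*n y n∣x))))

IsImage-∣ˢ : ∀ {n A B X E} → IsImage A B X E → n ∣ˢ X → n ∣ˢ E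
IsImage-∣ˢ {n} {A} {B} {X} {E} (image E₁ E₂ Eₛ) (n∣x , n∣y , n∣s) =
  subst (+ n ∣_) (sym E₁) (n∣lincomb (e12 A) (e12 B)) ,
  subst (+ n ∣_) (sym E₂) (n∣lincomb (e23 A) (e23 B)) ,
  subst (+ n ∣_) (sym Eₛ) (∣m∣n⇒∣m+n (n∣lincomb (symCentre A) (symCentre B)) (∣m⇒∣m*n (det A B) n∣s))
  where
  n∣lincomb : ∀ a b → + n ∣ e12 X * a + e23 X * b
  n∣lincomb a b = ∣m∣n⇒∣m+n (∣m⇒∣m*n a n∣x) (∣m⇒∣m*n b n∣y)

InR-preserved : ∀ {n φ} → Odd n → IsEndF₂ φ → ∀ w → InR n w → InR n (φ w)
InR-preserved {n} {φ} odd end w w∈R =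
  ∣ˢ⇒IsIdₙ (eval (φ w)) odd (IsImage-∣ˢ (IsImage-eval w) (IsIdₙ⇒∣ˢ n (eval w) w∈R))
  where
  open IsEndF₂ end
  open HomToHeisenberg (eval ∘ φ) (eval-cong ∘ φ-cong)
         (λ u v → trans (eval-cong (φ-hom u v)) (eval-++ (φ u) (φ v)))

lemma2p16 : (n : ℕ) → Odd n → (φ : Word → Word) → IsAutF₂ φ →
              ((w : Word) → InR n w → InR n (φ w))
              × ((w : Word) → InR n w → ∃ λ v → InR n v × φ v ≈ w)
lemma2p16 n odd φ aut =
  InR-preserved odd isEnd ,
  λ w w∈R → φ⁻¹ w , InR-preserved odd isEnd⁻¹ w w∈R , φ∘φ⁻¹ w
  where open AutF₂ aut
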